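{- Let $R$ be a ring of characteristic $p$. Suppose $M=(m_{ij})$, $M'=(m'_{ij})\in U_n(R)$ and $B=(b_{ij})\in U_n(R)$ satisfy $M=B^{(p)}M'B^{ -1}$. Then for each pair $1\le i<j\le n$ there exists an element $C$ of the subring of $R$ generated (as a $\mathbb{Z}$-algebra) by $\{m_{i'j'},b_{i'j'},m'_{i'j'} : i'<j',\ j'-i'<j-i\}$ such that $m_{ij}=\wp(b_{ij})+m'_{ij}+C$.
   Context: $U_n(R)$ is the group of upper triangular $n\times n$ matrices over $R$ with all diagonal entries $1$; $B^{(p)}$ is the entrywise $p$-th power of $B$; $\wp(f)=f^p-f$. Thus the conclusion says $m_{ij}\equiv\wp(b_{ij})+m'_{ij}$ modulo entries on the diagonals strictly closer to the main diagonal. -}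

module Defs where

open import Level using (Level; _⊔_)
open import Algebra.Bundles using (CommutativeRing)
open import Data.Nat as ℕ using (ℕ; zero; suc)
open import Data.Nat.Primality using (Prime)
open import Data.Fin using (Fin; toℕ; suc; zero)
open import Data.Product using (Σ; ∃; _×_; _,_)
open import Data.Sum using (_⊎_)
open import Relation.Nullary using (¬_)

module _ {c ℓ : Level} (R : CommutativeRing c ℓ) where
  open CommutativeRing R hiding (zero)

  natCast : ℕ → Carrier
  natCast zero = 0#
  natCast (suc k) = 1# + natCast k

  pow : Carrier → ℕ → Carrier
  pow x zero = 1#
  pow x (suc k) = x * pow x k

  HasChar : ℕ → Set ℓ
  HasChar p = (0 ℕ.< p) × (natCast p ≈ 0#) × (∀ k → 0 ℕ.< k → k ℕ.< p → ¬ (natCast k ≈ 0#))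

  ℘ : ℕ → Carrier → Carrier
  ℘ p f = pow f p - f

  Matrix : ℕ → Set c
  Matrix n = Fin n → Fin n → Carrier

  Σ[_] : ∀ {n} → (Fin n → Carrier) → Carrier
  Σ[_] {zero} f = 0#
  Σ[_] {suc n} f = f zero + Σ[_] (λ i → f (suc i))

  _⊗_ : ∀ {n} → Matrix n → Matrix n → Matrix n
  (A ⊗ B) i j = Σ[ (λ k → A i k * B k j) ]

  identity : ∀ {n} → Matrix n
  identity i j with toℕ i ℕ.≟ toℕ j
  ... | Relation.Nullary.yes _ = 1#
  ... | Relation.Nullary.no _ = 0#

  _≈ᴹ_ : ∀ {n} → Matrix n → Matrix n → Set ℓ
  A ≈ᴹ B = ∀ i j → A i j ≈ B i j

  frob : ∀ {n} → ℕ → Matrix n → Matrix n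
  frob p B i j = pow (B i j) p

  IsUnitriangular : ∀ {n} → Matrix n → Set ℓ
  IsUnitriangular A = (∀ i → A i i ≈ 1#) × (∀ i j → toℕ j ℕ.< toℕ i → A i j ≈ 0#)

  data SubringGen (S : Carrier → Set ℓ) : Carrier → Set (c ⊔ ℓ) where
    gen  : ∀ {x} → S x → SubringGen S x
    zr   : SubringGen S 0#
    one  : SubringGen S 1#
    neg  : ∀ {x} → SubringGen S x → SubringGen S (- x)
    add  : ∀ {x y} → SubringGen S x → SubringGen S y → SubringGen S (x + y)
    mul  : ∀ {x y} → SubringGen S x → SubringGen S y → SubringGen S (x * y)
    resp : ∀ {x y} → x ≈ y → SubringGen S x → SubringGen S y

  LowerDiagEntries : ∀ {n} → Matrix n → Matrix n → Matrix n → ℕ → Carrier → Set ℓ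
  LowerDiagEntries M B M' d x =
    Σ (Fin _) λ i' → Σ (Fin _) λ j' →
      (toℕ i' ℕ.< toℕ j') × ((toℕ j' ℕ.∸ toℕ i') ℕ.< d) ×
      ((x ≈ M i' j') ⊎ (x ≈ B i' j') ⊎ (x ≈ M' i' j'))

module Submission where

-- For M = B^(p) M' B⁻¹ with M, M', B upper unitriangular, multiplying on the
-- right by B gives  M B = B^(p) M'.  For unitriangular X, Y and i < j,
--     (X Y)_ij = X_ij + Y_ij + Σ_{i<k<j} X_ik Y_kj,
-- and each product X_ik Y_kj involves only entries on diagonals strictly
-- closer to the main diagonal than (i,j).  Since B^(p) is again unitriangular
-- with entries p-th powers of entries of B, both sides of  M B = B^(p) M'
-- expand to  m_ij + b_ij + C₁ = b_ij^p + m'_ij + C₂  with C₁, C₂ in the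
-- subring generated by the lower diagonals, so m_ij = ℘(b_ij) + m'_ij + (C₂ - C₁).

open import Defs
open import Level using (Level; _⊔_)
open import Algebra.Bundles using (CommutativeRing)
open import Data.Nat using (ℕ; _<_; _∸_)
import Data.Nat as ℕ
import Data.Nat.Properties as ℕ
open import Data.Nat.Primality using (Prime)
open import Data.Fin using (Fin; toℕ; zero; suc)
open import Data.Fin.Properties using (_≟_; toℕ-injective)
open import Data.Product using (Σ; _×_; _,_)
open import Data.Sum using (_⊎_; inj₁; inj₂)
open import Data.Empty using (⊥-elim)
open import Relation.Binary.PropositionalEquality as P using (_≢_)
open import Relation.Binary.Definitions using (tri<; tri≈; tri>)
open import Relation.Nullary using (yes; no)
import Algebra.Solver.CommutativeMonoid as CommutativeMonoidSolver

left-diagonal-shorter : ∀ {i k j} → i < k → k < j → k ∸ i < j ∸ i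
left-diagonal-shorter i<k k<j = ℕ.∸-monoˡ-< k<j (ℕ.<⇒≤ i<k)

right-diagonal-shorter : ∀ {i k j} → i < k → k < j → j ∸ k < j ∸ i
right-diagonal-shorter i<k k<j = ℕ.∸-monoʳ-< i<k (ℕ.<⇒≤ k<j)

module UnitriangularAlgebra {c ℓ : Level} (R : CommutativeRing c ℓ) where
  open CommutativeRing R hiding (zero)
  open import Relation.Binary.Reasoning.Setoid setoid
  open import Algebra.Properties.Group +-group using (//-rightDividesʳ)
  open import Algebra.Properties.AbelianGroup +-abelianGroup using (⁻¹-∙-comm)
  open CommutativeMonoidSolver +-commutativeMonoid using (solve; _⊜_; _⊕_)
    renaming (id to ε′)

  ∑ : ∀ {n} → (Fin n → Carrier) → Carrier
  ∑ = Σ[_] R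

  _·_ : ∀ {n} → Matrix R n → Matrix R n → Matrix R n
  _·_ = _⊗_ R

  _≋_ : ∀ {n} → Matrix R n → Matrix R n → Set ℓ
  _≋_ = _≈ᴹ_ R

  ∑-cong : ∀ {n} {f g : Fin n → Carrier} → (∀ k → f k ≈ g k) → ∑ f ≈ ∑ g
  ∑-cong {ℕ.zero}  f≈g = refl
  ∑-cong {ℕ.suc n} f≈g = +-cong (f≈g zero) (∑-cong (λ k → f≈g (suc k)))

  ∑-zero : ∀ n → ∑ {n} (λ _ → 0#) ≈ 0#
  ∑-zero ℕ.zero    = refl
  ∑-zero (ℕ.suc n) = trans (+-identityˡ _) (∑-zero n)

  +-interchange : ∀ a b x y → (a + b) + (x + y) ≈ (a + x) + (b + y)
  +-interchange = solve 4 (λ a b x y → (a ⊕ b) ⊕ (x ⊕ y) ⊜ (a ⊕ x) ⊕ (b ⊕ y)) refl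

  ∑-+ : ∀ {n} (f g : Fin n → Carrier) → ∑ (λ k → f k + g k) ≈ ∑ f + ∑ g
  ∑-+ {ℕ.zero}  f g = sym (+-identityˡ 0#)
  ∑-+ {ℕ.suc n} f g = trans (+-congˡ (∑-+ (λ k → f (suc k)) (λ k → g (suc k))))
                            (+-interchange _ _ _ _)

  ∑-*ʳ : ∀ {n} (f : Fin n → Carrier) z → ∑ f * z ≈ ∑ (λ k → f k * z)
  ∑-*ʳ {ℕ.zero}  f z = zeroˡ z
  ∑-*ʳ {ℕ.suc n} f z = trans (distribʳ z _ _) (+-congˡ (∑-*ʳ (λ k → f (suc k)) z))

  ∑-*ˡ : ∀ {n} (f : Fin n → Carrier) z → z * ∑ f ≈ ∑ (λ k → z * f k)
  ∑-*ˡ {ℕ.zero}  f z = zeroʳ z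
  ∑-*ˡ {ℕ.suc n} f z = trans (distribˡ z _ _) (+-congˡ (∑-*ˡ (λ k → f (suc k)) z))

  ∑-swap : ∀ {m n} (f : Fin m → Fin n → Carrier) →
           ∑ (λ k → ∑ (λ l → f k l)) ≈ ∑ (λ l → ∑ (λ k → f k l))
  ∑-swap {ℕ.zero}  {n} f = sym (∑-zero n)
  ∑-swap {ℕ.suc m} f = trans (+-congˡ (∑-swap (λ k l → f (suc k) l)))
                             (sym (∑-+ (λ l → f zero l) (λ l → ∑ (λ k → f (suc k) l))))

  ∑-closed : ∀ {Q n} (f : Fin n → Carrier) →
             (∀ k → SubringGen R Q (f k)) → SubringGen R Q (∑ f)
  ∑-closed {n = ℕ.zero}  f f∈ = zr
  ∑-closed {n = ℕ.suc n} f f∈ = add (f∈ zero) (∑-closed (λ k → f (suc k)) (λ k → f∈ (suc k)))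

  δ : ∀ {n} → Fin n → Fin n → Carrier
  δ zero    zero    = 1#
  δ zero    (suc _) = 0#
  δ (suc _) zero    = 0#
  δ (suc k) (suc l) = δ k l

  δ-diagonal : ∀ {n} (k : Fin n) → δ k k ≈ 1#
  δ-diagonal zero    = refl
  δ-diagonal (suc k) = δ-diagonal k

  δ-off-diagonal : ∀ {n} {k l : Fin n} → k ≢ l → δ k l ≈ 0#
  δ-off-diagonal {k = zero}  {zero}  k≢l = ⊥-elim (k≢l P.refl)
  δ-off-diagonal {k = zero}  {suc l} k≢l = refl
  δ-off-diagonal {k = suc k} {zero}  k≢l = refl
  δ-off-diagonal {k = suc k} {suc l} k≢l = δ-off-diagonal (λ k≡l → k≢l (P.cong suc k≡l))

  identity≈δ : ∀ {n} (k l : Fin n) → identity R k l ≈ δ k l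
  identity≈δ k l with toℕ k ℕ.≟ toℕ l
  ... | yes k≡l with toℕ-injective k≡l
  ...   | P.refl = sym (δ-diagonal k)
  identity≈δ k l | no k≢l = sym (δ-off-diagonal (λ k≡l → k≢l (P.cong toℕ k≡l)))

  ∑-δ : ∀ {n} (l : Fin n) (f : Fin n → Carrier) → ∑ (λ k → δ k l * f k) ≈ f l
  ∑-δ {ℕ.suc n} zero f = begin
    1# * f zero + ∑ (λ k → 0# * f (suc k))
      ≈⟨ +-cong (*-identityˡ _) (∑-cong (λ k → zeroˡ (f (suc k)))) ⟩
    f zero + ∑ {n} (λ _ → 0#) ≈⟨ +-congˡ (∑-zero n) ⟩
    f zero + 0#               ≈⟨ +-identityʳ _ ⟩
    f zero                    ∎
  ∑-δ {ℕ.suc n} (suc l) f = begin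
    0# * f zero + ∑ (λ k → δ k l * f (suc k)) ≈⟨ +-cong (zeroˡ _) (∑-δ l (λ k → f (suc k))) ⟩
    0# + f (suc l)                            ≈⟨ +-identityˡ _ ⟩
    f (suc l)                                 ∎

  ·-congʳ : ∀ {n} {X X' : Matrix R n} (Y : Matrix R n) → X ≋ X' → (X · Y) ≋ (X' · Y)
  ·-congʳ Y X≋X' i j = ∑-cong (λ k → *-congʳ (X≋X' i k))

  ·-congˡ : ∀ {n} (X : Matrix R n) {Y Y' : Matrix R n} → Y ≋ Y' → (X · Y) ≋ (X · Y')
  ·-congˡ X Y≋Y' i j = ∑-cong (λ k → *-congˡ (Y≋Y' k j))

  ·-assoc : ∀ {n} (X Y Z : Matrix R n) → ((X · Y) · Z) ≋ (X · (Y · Z))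
  ·-assoc X Y Z i j = begin
    ∑ (λ k → ∑ (λ l → X i l * Y l k) * Z k j)
      ≈⟨ ∑-cong (λ k → ∑-*ʳ (λ l → X i l * Y l k) (Z k j)) ⟩
    ∑ (λ k → ∑ (λ l → (X i l * Y l k) * Z k j))
      ≈⟨ ∑-swap (λ k l → (X i l * Y l k) * Z k j) ⟩
    ∑ (λ l → ∑ (λ k → (X i l * Y l k) * Z k j))
      ≈⟨ ∑-cong (λ l → ∑-cong (λ k → *-assoc (X i l) (Y l k) (Z k j))) ⟩
    ∑ (λ l → ∑ (λ k → X i l * (Y l k * Z k j)))
      ≈⟨ ∑-cong (λ l → sym (∑-*ˡ (λ k → Y l k * Z k j) (X i l))) ⟩
    ∑ (λ l → X i l * ∑ (λ k → Y l k * Z k j)) ∎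

  ·-identityʳ : ∀ {n} (X : Matrix R n) → (X · identity R) ≋ X
  ·-identityʳ X i j = begin
    ∑ (λ k → X i k * identity R k j)
      ≈⟨ ∑-cong (λ k → trans (*-congˡ (identity≈δ k j)) (*-comm _ _)) ⟩
    ∑ (λ k → δ k j * X i k) ≈⟨ ∑-δ j (X i) ⟩
    X i j                   ∎

  cancel-inverseʳ : ∀ {n} {M A B B⁻¹ : Matrix R n} →
    M ≋ (A · B⁻¹) → (B⁻¹ · B) ≋ identity R → (M · B) ≋ A
  cancel-inverseʳ {M = M} {A} {B} {B⁻¹} M≋AB⁻¹ B⁻¹B≋I i j = begin
    (M · B) i j             ≈⟨ ·-congʳ B M≋AB⁻¹ i j ⟩
    ((A · B⁻¹) · B) i j     ≈⟨ ·-assoc A B⁻¹ B i j ⟩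
    (A · (B⁻¹ · B)) i j     ≈⟨ ·-congˡ A B⁻¹B≋I i j ⟩
    (A · identity R) i j    ≈⟨ ·-identityʳ A i j ⟩
    A i j                   ∎

  away : ∀ {n} (i j : Fin n) (t : Fin n → Carrier) → Fin n → Carrier
  away i j t k with k ≟ i | k ≟ j
  ... | yes _ | _     = 0#
  ... | no _  | yes _ = 0#
  ... | no _  | no _  = t k

  δ-scale-off : ∀ {n} {k l : Fin n} x → k ≢ l → δ k l * x ≈ 0#
  δ-scale-off x k≢l = trans (*-congʳ (δ-off-diagonal k≢l)) (zeroˡ x)

  δ-scale-diagonal : ∀ {n} (k : Fin n) x → δ k k * x ≈ x
  δ-scale-diagonal k x = trans (*-congʳ (δ-diagonal k)) (*-identityˡ x)

  split-term : ∀ {n} {i j : Fin n} (t : Fin n → Carrier) → i ≢ j → ∀ k →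
    t k ≈ (δ k i * t i + δ k j * t j) + away i j t k
  split-term {i = i} {j} t i≢j k with k ≟ i | k ≟ j
  ... | yes P.refl | _ = begin
    t k               ≈⟨ solve 1 (λ x → x ⊜ (x ⊕ ε′) ⊕ ε′) refl (t k) ⟩
    (t k + 0#) + 0#   ≈⟨ +-congʳ (sym (+-cong (δ-scale-diagonal k (t k)) (δ-scale-off (t j) i≢j))) ⟩
    (δ k k * t k + δ k j * t j) + 0# ∎
  ... | no k≢i | yes P.refl = begin
    t k               ≈⟨ solve 1 (λ x → x ⊜ (ε′ ⊕ x) ⊕ ε′) refl (t k) ⟩
    (0# + t k) + 0#   ≈⟨ +-congʳ (sym (+-cong (δ-scale-off (t i) k≢i) (δ-scale-diagonal k (t k)))) ⟩
    (δ k i * t i + δ k k * t k) + 0# ∎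
  ... | no k≢i | no k≢j = begin
    t k               ≈⟨ solve 1 (λ x → x ⊜ (ε′ ⊕ ε′) ⊕ x) refl (t k) ⟩
    (0# + 0#) + t k   ≈⟨ +-congʳ (sym (+-cong (δ-scale-off (t i) k≢i) (δ-scale-off (t j) k≢j))) ⟩
    (δ k i * t i + δ k j * t j) + t k ∎

  away-closed : ∀ {Q n} {i j : Fin n} (t : Fin n → Carrier) →
    (∀ k → k ≢ i → k ≢ j → SubringGen R Q (t k)) → ∀ k → SubringGen R Q (away i j t k)
  away-closed {i = i} {j} t t∈ k with k ≟ i | k ≟ j
  ... | yes _  | _      = zr
  ... | no _   | yes _  = zr
  ... | no k≢i | no k≢j = t∈ k k≢i k≢j

  ∑-split₂ : ∀ {Q n} {i j : Fin n} (t : Fin n → Carrier) → i ≢ j →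
    (∀ k → k ≢ i → k ≢ j → SubringGen R Q (t k)) →
    Σ Carrier λ C → SubringGen R Q C × (∑ t ≈ (t i + t j) + C)
  ∑-split₂ {i = i} {j} t i≢j t∈ = ∑ (away i j t) , ∑-closed _ (away-closed t t∈) , (begin
    ∑ t ≈⟨ ∑-cong (split-term t i≢j) ⟩
    ∑ (λ k → (δ k i * t i + δ k j * t j) + away i j t k)
      ≈⟨ trans (∑-+ (λ k → δ k i * t i + δ k j * t j) (away i j t))
               (+-congʳ (∑-+ (λ k → δ k i * t i) (λ k → δ k j * t j))) ⟩
    (∑ (λ k → δ k i * t i) + ∑ (λ k → δ k j * t j)) + ∑ (away i j t)
      ≈⟨ +-congʳ (+-cong (∑-δ i (λ _ → t i)) (∑-δ j (λ _ → t j))) ⟩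
    (t i + t j) + ∑ (away i j t) ∎)

  zero-closed : ∀ {Q x} → x ≈ 0# → SubringGen R Q x
  zero-closed x≈0 = resp (sym x≈0) zr

  unitriangular-product-entry : ∀ {Q n} {X Y : Matrix R n} →
    IsUnitriangular R X → IsUnitriangular R Y → ∀ {i j} → toℕ i < toℕ j →
    (∀ k → toℕ i < toℕ k → toℕ k < toℕ j → SubringGen R Q (X i k * Y k j)) →
    Σ Carrier λ C → SubringGen R Q C × ((X · Y) i j ≈ (X i j + Y i j) + C)
  unitriangular-product-entry {Q} {X = X} {Y} (X-diag , X-lower) (Y-diag , Y-lower) {i} {j} i<j inner
    with ∑-split₂ (λ k → X i k * Y k j) (λ j≡i → ℕ.<⇒≢ i<j (P.cong toℕ (P.sym j≡i))) outer
    where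
    outer : ∀ k → k ≢ j → k ≢ i → SubringGen R Q (X i k * Y k j)
    outer k k≢j k≢i with ℕ.<-cmp (toℕ k) (toℕ i)
    ... | tri< k<i _ _ = zero-closed (trans (*-congʳ (X-lower i k k<i)) (zeroˡ _))
    ... | tri≈ _ k≡i _ = ⊥-elim (k≢i (toℕ-injective k≡i))
    ... | tri> _ _ i<k with ℕ.<-cmp (toℕ k) (toℕ j)
    ...   | tri< k<j _ _ = inner k i<k k<j
    ...   | tri≈ _ k≡j _ = ⊥-elim (k≢j (toℕ-injective k≡j))
    ...   | tri> _ _ j<k = zero-closed (trans (*-congˡ (Y-lower k j j<k)) (zeroʳ _))
  ... | C , C∈ , sum≈ = C , C∈ , trans sum≈ (+-congʳ (+-cong
          (trans (*-congˡ (Y-diag j)) (*-identityʳ _))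
          (trans (*-congʳ (X-diag i)) (*-identityˡ _))))

  pow-cong : ∀ {x y} k → x ≈ y → pow R x k ≈ pow R y k
  pow-cong ℕ.zero    x≈y = refl
  pow-cong (ℕ.suc k) x≈y = *-cong x≈y (pow-cong k x≈y)

  pow-one : ∀ k → pow R 1# k ≈ 1#
  pow-one ℕ.zero    = refl
  pow-one (ℕ.suc k) = trans (*-congˡ (pow-one k)) (*-identityˡ 1#)

  pow-closed : ∀ {Q x} k → SubringGen R Q x → SubringGen R Q (pow R x k)
  pow-closed ℕ.zero    x∈ = one
  pow-closed (ℕ.suc k) x∈ = mul x∈ (pow-closed k x∈)

  frob-unitriangular : ∀ {n p} {A : Matrix R n} → 0 < p →
    IsUnitriangular R A → IsUnitriangular R (frob R p A)
  frob-unitriangular {p = ℕ.suc q} _ (A-diag , A-lower) =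
      (λ i → trans (pow-cong (ℕ.suc q) (A-diag i)) (pow-one (ℕ.suc q)))
    , (λ i j j<i → trans (*-congʳ (A-lower i j j<i)) (zeroˡ _))

  solve-for-entry : ∀ m b c₁ q m' c₂ → (m + b) + c₁ ≈ (q + m') + c₂ →
    m ≈ ((q - b) + m') + (c₂ - c₁)
  solve-for-entry m b c₁ q m' c₂ eq = begin
    m                              ≈⟨ sym (//-rightDividesʳ (b + c₁) m) ⟩
    (m + (b + c₁)) - (b + c₁)      ≈⟨ +-congʳ (sym (+-assoc m b c₁)) ⟩
    ((m + b) + c₁) - (b + c₁)      ≈⟨ +-congʳ eq ⟩
    ((q + m') + c₂) - (b + c₁)     ≈⟨ +-congˡ (sym (⁻¹-∙-comm b c₁)) ⟩
    ((q + m') + c₂) + (- b + - c₁)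
      ≈⟨ solve 5 (λ q m' c₂ b̄ c̄₁ → ((q ⊕ m') ⊕ c₂) ⊕ (b̄ ⊕ c̄₁) ⊜ ((q ⊕ b̄) ⊕ m') ⊕ (c₂ ⊕ c̄₁))
               refl q m' c₂ (- b) (- c₁) ⟩
    ((q - b) + m') + (c₂ - c₁)     ∎

lemma3p1 : ∀ {c ℓ} (R : CommutativeRing c ℓ) (p : ℕ) → Prime p → HasChar R p →
    (n : ℕ) (M M' B Binv : Matrix R n) →
    IsUnitriangular R M → IsUnitriangular R M' → IsUnitriangular R B →
    _≈ᴹ_ R (_⊗_ R B Binv) (identity R) → _≈ᴹ_ R (_⊗_ R Binv B) (identity R) →
    _≈ᴹ_ R M (_⊗_ R (_⊗_ R (frob R p B) M') Binv) →
    (i j : Fin n) → toℕ i < toℕ j →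
    Σ (CommutativeRing.Carrier R) λ C →
    SubringGen R (LowerDiagEntries R M B M' (toℕ j ∸ toℕ i)) C ×
    CommutativeRing._≈_ R (M i j)
    (CommutativeRing._+_ R (CommutativeRing._+_ R (℘ R p (B i j)) (M' i j)) C)
lemma3p1 {c} {ℓ} R p _ (0<p , _) _ M M' B Binv M-unitri M'-unitri B-unitri _ Binv·B≋I M≋ i j i<j =
  let C₁ , C₁∈ , M·B-entry = unitriangular-product-entry M-unitri B-unitri i<j
        (λ k i<k k<j → mul (entry-ik k i<k k<j (inj₁ refl)) (entry-kj k i<k k<j (inj₂ (inj₁ refl))))
      C₂ , C₂∈ , F·M'-entry = unitriangular-product-entry (frob-unitriangular 0<p B-unitri) M'-unitri i<j
        (λ k i<k k<j → mul (pow-closed p (entry-ik k i<k k<j (inj₂ (inj₁ refl))))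
                           (entry-kj k i<k k<j (inj₂ (inj₂ refl))))
      M·B≋F·M' : (M · B) ≋ (frob R p B · M')
      M·B≋F·M' = cancel-inverseʳ M≋ Binv·B≋I
  in C₂ - C₁ , add C₂∈ (neg C₁∈) ,
     solve-for-entry _ _ _ _ _ _ (trans (sym M·B-entry) (trans (M·B≋F·M' i j) F·M'-entry))
  where
  open UnitriangularAlgebra R
  open CommutativeRing R using (_≈_; _-_; refl; sym; trans)
  Generated : CommutativeRing.Carrier R → Set (c ⊔ ℓ)
  Generated = SubringGen R (LowerDiagEntries R M B M' (toℕ j ∸ toℕ i))
  entry-ik : ∀ k → toℕ i < toℕ k → toℕ k < toℕ j → ∀ {x} →
    (x ≈ M i k) ⊎ (x ≈ B i k) ⊎ (x ≈ M' i k) → Generated x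
  entry-ik k i<k k<j x≈ = gen (i , k , i<k , left-diagonal-shorter i<k k<j , x≈)
  entry-kj : ∀ k → toℕ i < toℕ k → toℕ k < toℕ j → ∀ {x} →
    (x ≈ M k j) ⊎ (x ≈ B k j) ⊎ (x ≈ M' k j) → Generated x
  entry-kj k i<k k<j x≈ = gen (k , j , k<j , right-diagonal-shorter i<k k<j , x≈)
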